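{- Fix $n$ divisible by $4$, an arbitrary integer $d$, and $\varepsilon>0$ such that $(0.7)^{d/n}<\varepsilon$ and $n\varepsilon<1/2$. Then there is a set $\mathcal{F}$ of functions $f:[n]^d\to\mathbb{F}_2$ such that, using fewer than $n/4$ queries to $f\in\mathcal{F}$, it is impossible to determine the value $L(\mathbb{1})$ with probability greater than $1/2$, where $L$ is the closest direct sum to $f$ and $\mathbb{1}=(1,\dots,1)\in[n]^d$.
   Context: $[n]=\{1,\dots,n\}$. A direct sum is a function $L:[n]^d\to\mathbb{F}_2$ of the form $L(x)=\sum_{i=1}^d L_i(x_i)$ with $L_i:[n]\to\mathbb{F}_2$. Distance between functions is the fraction of points of $[n]^d$ where they differ. -}

module Defs where

open import Data.Nat using (ℕ; zero; suc; _+_; _*_; _≤_; _<_)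
open import Data.Bool using (Bool; true; false; _xor_; if_then_else_)
open import Data.Fin using (Fin)
open import Data.Fin.Base using () renaming (zero to fzero; suc to fsuc)
open import Data.List using (List; []; _∷_; _++_; map; concatMap; allFin; length; filter)
open import Data.Vec using (Vec; []; _∷_; lookup; replicate)
open import Data.Product using (Σ; ∃; _×_; _,_)
open import Relation.Binary.PropositionalEquality using (_≡_)
open import Relation.Nullary using (¬_)
open import Relation.Nullary.Decidable using (⌊_⌋)
import Data.Bool.Properties as BP
import Data.Rational as ℚ

-- F₂ is modelled by Bool with addition _xor_.

-- Points of [n]^d, with [n] modelled as Fin n (0-indexed: element 1 of [n] is Fin zero).
Point : ℕ → ℕ → Set
Point n d = Vec (Fin n) d

BFun : ℕ → ℕ → Set
BFun n d = Point n d → Bool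

-- The all-ones point 𝟙 = (1,…,1) (first element of [n], which needs n ≥ 1).
one : ∀ {n} d → Point (suc n) d
one d = replicate d fzero

allPoints : (n d : ℕ) → List (Point n d)
allPoints n zero    = [] ∷ []
allPoints n (suc d) = concatMap (λ i → map (i ∷_) (allPoints n d)) (allFin n)

directSum : ∀ {n d} → (Fin d → Fin n → Bool) → BFun n d
directSum {d = zero}  Ls []      = false
directSum {d = suc d} Ls (x ∷ xs) = Ls fzero x xor directSum (λ i → Ls (fsuc i)) xs

IsDirectSum : ∀ {n d} → BFun n d → Set
IsDirectSum {n} {d} g = Σ (Fin d → Fin n → Bool) λ Ls → ∀ x → g x ≡ directSum Ls x

-- Number of points where f and g differ.  Distance = disagree f g / n^d; since the
-- denominator n^d is common, comparing distances is comparing these counts.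
countDiff : ∀ {n d} → BFun n d → BFun n d → List (Point n d) → ℕ
countDiff f g []       = 0
countDiff f g (x ∷ xs) = (if f x xor g x then 1 else 0) + countDiff f g xs

disagree : ∀ {n d} → BFun n d → BFun n d → ℕ
disagree {n} {d} f g = countDiff f g (allPoints n d)

IsClosestDirectSum : ∀ {n d} → BFun n d → BFun n d → Set
IsClosestDirectSum {n} {d} f L =
  IsDirectSum L × (∀ (L' : BFun n d) → IsDirectSum L' → disagree f L ≤ disagree f L')

IsUniqueClosestDirectSum : ∀ {n d} → BFun n d → BFun n d → Set
IsUniqueClosestDirectSum {n} {d} f L =
  IsClosestDirectSum f L × (∀ (L' : BFun n d) → IsClosestDirectSum f L' → ∀ x → L' x ≡ L x)

-- Deterministic adaptive query algorithms = decision trees: query a point, branch on the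
-- answer, eventually output a bit.
data DTree (n d : ℕ) : Set where
  leaf  : Bool → DTree n d
  query : Point n d → (Bool → DTree n d) → DTree n d

queries : ∀ {n d} → DTree n d → BFun n d → ℕ
queries (leaf b)    f = 0
queries (query x k) f = suc (queries (k (f x)) f)

run : ∀ {n d} → DTree n d → BFun n d → Bool
run (leaf b)    f = b
run (query x k) f = run (k (f x)) f

successes : ∀ {n d} → DTree (suc n) d → List (BFun (suc n) d × BFun (suc n) d) → ℕ
successes {d = d} t []             = 0
successes {d = d} t ((f , L) ∷ xs) =
  (if ⌊ run t f BP.≟ L (one d) ⌋ then 1 else 0) + successes t xs

_^ℚ_ : ℚ.ℚ → ℕ → ℚ.ℚ
q ^ℚ zero  = ℚ.1ℚ
q ^ℚ suc k = q ℚ.* (q ^ℚ k)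

-- For c ∈ F₂^d let L_c(x) = ∑ᵢ cᵢ·[xᵢ = 1], so that L_c(𝟙) is the parity of c, and let f_c agree with
-- L_c except that it vanishes on the exceptional points, those with more than 4d/n coordinates equal
-- to 1. Weighting each point by 2^(number of 1s) and applying Markov's inequality shows that, under
-- the hypotheses on ε, fewer than n^(d-1)/2 points are exceptional; since distinct direct sums differ
-- on at least n^(d-1) points, L_c is the unique closest direct sum to f_c. An unexceptional point has
-- at most 4d/n coordinates equal to 1, so fewer than n/4 queries leave a coordinate i that is 1 at no
-- unexceptional queried point. Flipping cᵢ then changes none of the answers, hence not the output,
-- but it flips L_c(𝟙): this pairs up the vectors c, and the algorithm is right on exactly one of each pair.

module Submission where

open import Defs
open import Data.Nat as ℕ
  using (ℕ; zero; suc; _+_; _*_; _^_; _≤_; _<_; _≤ᵇ_; _%_; _≟_; z≤n; s≤s)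
open import Data.Nat.Properties
open import Data.Nat.DivMod using (m≡m%n+[m/n]*n; m%n<n)
open import Data.Nat.Divisibility using (_∣_; divides)
open import Data.Nat.ListAction using (sum)
import Data.Nat.ListAction.Properties as Sum
open import Data.Nat.Tactic.RingSolver using (solve-∀)
import Data.Nat.Coprimality as Coprime
open import Data.Integer using (+_)
import Data.Integer.Properties as ℤ
open import Data.Rational using (ℚ; mkℚ; _/_; ½; 0ℚ; 1ℚ; *<*; positive; nonNegative)
  renaming (_<_ to _<ℚ_; _≤_ to _≤ℚ_; _*_ to _*ℚ_)
import Data.Rational.Properties as ℚ
open import Data.Bool using (Bool; true; false; not; _∧_; _xor_; if_then_else_; T)
import Data.Bool.Properties as Bool
open import Data.Fin using (Fin; zero; suc)
import Data.Fin.Properties as Fin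
open import Data.List using (List; []; _∷_; _++_; map; concatMap; allFin; length)
open import Data.List.Properties using (map-++; map-tabulate; length-map; length-tabulate; length-++)
open import Data.List.Relation.Unary.All as All using (All; []; _∷_)
open import Data.List.Relation.Unary.All.Properties using (map⁺)
open import Data.Vec using (Vec; []; _∷_; lookup; updateAt)
import Data.Vec.Properties as Vec
open import Data.Product using (Σ; ∃; _×_; _,_; proj₁; proj₂)
open import Data.Sum using (_⊎_; inj₁; inj₂)
open import Data.Unit using (tt)
open import Data.Empty using (⊥-elim)
open import Function using (id; _∘_)
open import Algebra.Bundles using (CommutativeRing)
import Algebra.Properties.CommutativeSemigroup as CommutativeSemigroup
open import Relation.Binary.Definitions using (DecidableEquality)
open import Relation.Binary.PropositionalEquality
open import Relation.Nullary using (yes; no; Dec)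
open import Relation.Nullary.Decidable using (does; ⌊_⌋)

open CommutativeSemigroup +-commutativeSemigroup using () renaming (interchange to +-interchange)
open CommutativeSemigroup (CommutativeRing.*-commutativeSemigroup ℚ.+-*-commutativeRing)
  using () renaming (interchange to *ℚ-interchange)

private variable A B : Set

indicator : Bool → ℕ
indicator b = if b then 1 else 0

∑ : List A → (A → ℕ) → ℕ
∑ xs f = sum (map f xs)

infix 5 ∑
syntax ∑ xs (λ x → e) = ∑[ x ← xs ] e

∑-++ : (xs ys : List A) (f : A → ℕ) → ∑ (xs ++ ys) f ≡ ∑ xs f + ∑ ys f
∑-++ xs ys f = trans (cong sum (map-++ f xs ys)) (Sum.sum-++ (map f xs) (map f ys))

∑-cong : {f g : A → ℕ} → (∀ x → f x ≡ g x) → (xs : List A) → ∑ xs f ≡ ∑ xs g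
∑-cong f≗g []       = refl
∑-cong f≗g (x ∷ xs) = cong₂ _+_ (f≗g x) (∑-cong f≗g xs)

∑-mono-≤ : {f g : A → ℕ} → (∀ x → f x ≤ g x) → (xs : List A) → ∑ xs f ≤ ∑ xs g
∑-mono-≤ f≤g []       = z≤n
∑-mono-≤ f≤g (x ∷ xs) = +-mono-≤ (f≤g x) (∑-mono-≤ f≤g xs)

∑-const : (xs : List A) (k : ℕ) → ∑[ _ ← xs ] k ≡ length xs * k
∑-const []       k = refl
∑-const (x ∷ xs) k = cong (_+_ k) (∑-const xs k)

∑-zero : (xs : List A) → ∑[ _ ← xs ] 0 ≡ 0
∑-zero xs = trans (∑-const xs 0) (*-zeroʳ (length xs))

length≡∑1 : (xs : List A) → length xs ≡ ∑[ _ ← xs ] 1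
length≡∑1 xs = sym (trans (∑-const xs 1) (*-identityʳ (length xs)))

∑-distrib-+ : (xs : List A) (f g : A → ℕ) → ∑[ x ← xs ] (f x + g x) ≡ ∑ xs f + ∑ xs g
∑-distrib-+ []       f g = refl
∑-distrib-+ (x ∷ xs) f g =
  trans (cong (_+_ (f x + g x)) (∑-distrib-+ xs f g)) (+-interchange (f x) (g x) (∑ xs f) (∑ xs g))

∑-*ˡ : (xs : List A) (k : ℕ) (f : A → ℕ) → ∑[ x ← xs ] (k * f x) ≡ k * ∑ xs f
∑-*ˡ []       k f = sym (*-zeroʳ k)
∑-*ˡ (x ∷ xs) k f = trans (cong (_+_ (k * f x)) (∑-*ˡ xs k f)) (sym (*-distribˡ-+ k (f x) _))

∑-*ʳ : (xs : List A) (k : ℕ) (f : A → ℕ) → ∑[ x ← xs ] (f x * k) ≡ ∑ xs f * k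
∑-*ʳ xs k f = trans (∑-cong (λ x → *-comm (f x) k) xs) (trans (∑-*ˡ xs k f) (*-comm k _))

∑-map : (g : A → B) (xs : List A) (f : B → ℕ) → ∑ (map g xs) f ≡ ∑[ x ← xs ] f (g x)
∑-map g []       f = refl
∑-map g (x ∷ xs) f = cong (_+_ (f (g x))) (∑-map g xs f)

∑-concatMap : (g : A → List B) (xs : List A) (f : B → ℕ) →
              ∑ (concatMap g xs) f ≡ ∑[ x ← xs ] ∑ (g x) f
∑-concatMap g []       f = refl
∑-concatMap g (x ∷ xs) f =
  trans (∑-++ (g x) (concatMap g xs) f) (cong (_+_ (∑ (g x) f)) (∑-concatMap g xs f))

∑-comm : (xs : List A) (ys : List B) (h : A → B → ℕ) →
         ∑[ x ← xs ] ∑[ y ← ys ] h x y ≡ ∑[ y ← ys ] ∑[ x ← xs ] h x y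
∑-comm []       ys h = sym (∑-zero ys)
∑-comm (x ∷ xs) ys h = trans (cong (_+_ (∑ ys (h x))) (∑-comm xs ys h))
                             (sym (∑-distrib-+ ys (h x) (λ y → ∑[ x ← xs ] h x y)))

∑≡0⇒All≡0 : (xs : List A) (f : A → ℕ) → ∑ xs f ≡ 0 → All (λ x → f x ≡ 0) xs
∑≡0⇒All≡0 []       f _ = []
∑≡0⇒All≡0 (x ∷ xs) f s≡0 =
  m+n≡0⇒m≡0 (f x) s≡0 ∷ ∑≡0⇒All≡0 xs f (m+n≡0⇒n≡0 (f x) s≡0)

∑-allFin-suc : (n : ℕ) (f : Fin (suc n) → ℕ) → ∑ (allFin (suc n)) f ≡ f zero + (∑[ i ← allFin n ] f (suc i))
∑-allFin-suc n f =
  cong (_+_ (f zero)) (trans (cong (λ is → ∑ is f) (sym (map-tabulate id suc))) (∑-map suc (allFin n) f))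

term≤∑-allFin : {n : ℕ} (f : Fin n → ℕ) (i : Fin n) → f i ≤ ∑ (allFin n) f
term≤∑-allFin {suc n} f zero    rewrite ∑-allFin-suc n f = m≤m+n (f zero) _
term≤∑-allFin {suc n} f (suc i) rewrite ∑-allFin-suc n f =
  ≤-trans (term≤∑-allFin (f ∘ suc) i) (m≤n+m _ (f zero))

∑-allPoints-suc : (n d : ℕ) (f : Point n (suc d) → ℕ) →
  ∑ (allPoints n (suc d)) f ≡ ∑[ i ← allFin n ] ∑[ xs ← allPoints n d ] f (i ∷ xs)
∑-allPoints-suc n d f = trans (∑-concatMap (λ i → map (i ∷_) (allPoints n d)) (allFin n) f)
  (∑-cong (λ i → ∑-map (i ∷_) (allPoints n d) f) (allFin n))

length-allPoints : (n d : ℕ) → length (allPoints n d) ≡ n ^ d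
length-allPoints n zero    = refl
length-allPoints n (suc d) = begin
  length (allPoints n (suc d))                        ≡⟨ length≡∑1 (allPoints n (suc d)) ⟩
  ∑[ _ ← allPoints n (suc d) ] 1                      ≡⟨ ∑-allPoints-suc n d (λ _ → 1) ⟩
  ∑[ _ ← allFin n ] ∑[ _ ← allPoints n d ] 1          ≡⟨ ∑-cong (λ _ → sym (length≡∑1 (allPoints n d))) (allFin n) ⟩
  ∑[ _ ← allFin n ] length (allPoints n d)            ≡⟨ ∑-const (allFin n) _ ⟩
  length (allFin n) * length (allPoints n d)          ≡⟨ cong₂ _*_ (length-tabulate {n = n} id) (length-allPoints n d) ⟩
  n * n ^ d                                           ∎
  where open ≡-Reasoning

xor-interchange : ∀ a b c d → (a xor b) xor (c xor d) ≡ (a xor c) xor (b xor d)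
xor-interchange false b false d = refl
xor-interchange false b true  d = sym (Bool.not-distribʳ-xor b d)
xor-interchange true  b false d = sym (Bool.not-distribˡ-xor b d)
xor-interchange true  b true  d = Bool.xor-annihilates-not b d

xor≡false⇒≡ : ∀ {a b} → a xor b ≡ false → a ≡ b
xor≡false⇒≡ {false} {false} _ = refl
xor≡false⇒≡ {true}  {true}  _ = refl

≢⇒≡not : ∀ {a b : Bool} → a ≢ b → a ≡ not b
≢⇒≡not {false} {false} a≢b = ⊥-elim (a≢b refl)
≢⇒≡not {false} {true}  _   = refl
≢⇒≡not {true}  {false} _   = refl
≢⇒≡not {true}  {true}  a≢b = ⊥-elim (a≢b refl)

indicator-xor-triangle : ∀ a b c → indicator (b xor c) ≤ indicator (a xor b) + indicator (a xor c)
indicator-xor-triangle false false false = z≤n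
indicator-xor-triangle false false true  = s≤s z≤n
indicator-xor-triangle false true  false = s≤s z≤n
indicator-xor-triangle false true  true  = z≤n
indicator-xor-triangle true  false false = z≤n
indicator-xor-triangle true  false true  = s≤s z≤n
indicator-xor-triangle true  true  false = s≤s z≤n
indicator-xor-triangle true  true  true  = z≤n

directSum-xor : ∀ {n d} (Ls Ls′ : Fin d → Fin n → Bool) x →
  directSum Ls x xor directSum Ls′ x ≡ directSum (λ i v → Ls i v xor Ls′ i v) x
directSum-xor Ls Ls′ []       = refl
directSum-xor Ls Ls′ (v ∷ xs) = trans (xor-interchange (Ls zero v) _ (Ls′ zero v) _)
  (cong ((Ls zero v xor Ls′ zero v) xor_) (directSum-xor (λ i → Ls (suc i)) (λ i → Ls′ (suc i)) xs))

directSum-cong : ∀ {n d} (Ls Ls′ : Fin d → Fin n → Bool) (x : Point n d) →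
  (∀ j → Ls j (lookup x j) ≡ Ls′ j (lookup x j)) → directSum Ls x ≡ directSum Ls′ x
directSum-cong Ls Ls′ []       agree = refl
directSum-cong Ls Ls′ (v ∷ xs) agree =
  cong₂ _xor_ (agree zero) (directSum-cong (λ j → Ls (suc j)) (λ j → Ls′ (suc j)) xs (λ j → agree (suc j)))

weight : ∀ {n d} → BFun n d → ℕ
weight {n} {d} h = ∑[ x ← allPoints n d ] indicator (h x)

disagree≡weight : ∀ {n d} (f g : BFun n d) → disagree f g ≡ weight (λ x → f x xor g x)
disagree≡weight {n} {d} f g = go (allPoints n d)
  where
  go : ∀ xs → countDiff f g xs ≡ ∑[ x ← xs ] indicator (f x xor g x)
  go []       = refl
  go (x ∷ xs) = cong (_+_ (indicator (f x xor g x))) (go xs)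

-- On each slice x₁ = i, the affine direct sum b + ∑ Lⱼ(xⱼ) is again affine, with offset b + L₁(i).
affine-zero-or-heavy : ∀ {m} d (Ls : Fin d → Fin (suc m) → Bool) (b : Bool) →
  (∀ x → b xor directSum Ls x ≡ false) ⊎ suc m ^ d ≤ suc m * weight (λ x → b xor directSum Ls x)
affine-zero-or-heavy zero    Ls false = inj₁ λ { [] → refl }
affine-zero-or-heavy zero    Ls true  = inj₂ (s≤s z≤n)
affine-zero-or-heavy {m} (suc d) Ls b =
  combine (affine-zero-or-heavy d Ls′ false) (affine-zero-or-heavy d Ls′ true)
  where
  n = suc m
  Ls′ = λ i → Ls (suc i)
  offset : Fin n → Bool
  offset i = b xor Ls zero i
  h : BFun n (suc d)
  h x = b xor directSum Ls x
  slice : Bool → BFun n d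
  slice c xs = c xor directSum Ls′ xs

  h-slice : ∀ i xs → h (i ∷ xs) ≡ slice (offset i) xs
  h-slice i xs = sym (Bool.xor-assoc b (Ls zero i) (directSum Ls′ xs))

  weight-slices : weight h ≡ ∑[ i ← allFin n ] weight (slice (offset i))
  weight-slices = trans (∑-allPoints-suc n d (λ x → indicator (h x)))
    (∑-cong (λ i → ∑-cong (λ xs → cong indicator (h-slice i xs)) (allPoints n d)) (allFin n))

  fromZeroSlice : ∀ c → (∀ xs → slice c xs ≡ false) → (∀ x → h x ≡ false) ⊎ n ^ suc d ≤ n * weight h
  fromZeroSlice c zero-slice with Fin.all? (λ i → offset i Bool.≟ c)
  ... | yes offset≡c = inj₁ λ { (i ∷ xs) → trans (h-slice i xs)
                                  (trans (cong (λ c′ → slice c′ xs) (offset≡c i)) (zero-slice xs)) }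
  ... | no ¬offset≡c with Fin.¬∀⟶∃¬ n (λ i → offset i ≡ c) (λ i → offset i Bool.≟ c) ¬offset≡c
  ... | i , offset≢c = inj₂ (*-monoʳ-≤ n (begin
      n ^ d                                        ≡⟨ sym (length-allPoints n d) ⟩
      length (allPoints n d)                       ≡⟨ length≡∑1 (allPoints n d) ⟩
      ∑[ _ ← allPoints n d ] 1                     ≡⟨ ∑-cong (λ xs → cong indicator (sym (slice-i-true xs))) (allPoints n d) ⟩
      weight (slice (offset i))                    ≤⟨ term≤∑-allFin (λ j → weight (slice (offset j))) i ⟩
      ∑[ j ← allFin n ] weight (slice (offset j))  ≡⟨ sym weight-slices ⟩
      weight h                                     ∎))
    where
    open ≤-Reasoning
    slice-i-true : ∀ xs → slice (offset i) xs ≡ true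
    slice-i-true xs = trans (cong (_xor directSum Ls′ xs) (≢⇒≡not offset≢c))
      (trans (sym (Bool.not-distribˡ-xor c (directSum Ls′ xs))) (cong not (zero-slice xs)))

  combine : (∀ xs → slice false xs ≡ false) ⊎ n ^ d ≤ n * weight (slice false)
          → (∀ xs → slice true xs ≡ false)  ⊎ n ^ d ≤ n * weight (slice true)
          → (∀ x → h x ≡ false) ⊎ n ^ suc d ≤ n * weight h
  combine (inj₁ zero-slice) _                 = fromZeroSlice false zero-slice
  combine (inj₂ _)          (inj₁ zero-slice) = fromZeroSlice true zero-slice
  combine (inj₂ heavy₀)     (inj₂ heavy₁)     = inj₂ (begin
    n * n ^ d                                        ≡⟨ cong (_* n ^ d) (sym (length-tabulate {n = n} id)) ⟩
    length (allFin n) * n ^ d                        ≡⟨ sym (∑-const (allFin n) (n ^ d)) ⟩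
    ∑[ _ ← allFin n ] n ^ d                          ≤⟨ ∑-mono-≤ (λ i → heavy (offset i)) (allFin n) ⟩
    ∑[ i ← allFin n ] n * weight (slice (offset i))  ≡⟨ ∑-*ˡ (allFin n) n (λ i → weight (slice (offset i))) ⟩
    n * (∑[ i ← allFin n ] weight (slice (offset i))) ≡⟨ cong (n *_) (sym weight-slices) ⟩
    n * weight h                                     ∎)
    where
    open ≤-Reasoning
    heavy : ∀ c → n ^ d ≤ n * weight (slice c)
    heavy false = heavy₀
    heavy true  = heavy₁

disagree-cong : ∀ {n d} (f : BFun n d) {g h : BFun n d} → (∀ x → g x ≡ h x) → disagree f g ≡ disagree f h
disagree-cong {n} {d} f {g} {h} g≗h = trans (disagree≡weight f g)
  (trans (∑-cong (λ x → cong (λ y → indicator (f x xor y)) (g≗h x)) (allPoints n d))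
         (sym (disagree≡weight f h)))

-- Distinct direct sums differ on at least n^(d-1) points; then use the triangle inequality.
directSum-equal-or-far : ∀ {m d} (f : BFun (suc m) d) (Ls : Fin d → Fin (suc m) → Bool)
  (L′ : BFun (suc m) d) → IsDirectSum L′ →
  (∀ x → L′ x ≡ directSum Ls x) ⊎ suc m ^ d ≤ suc m * (disagree f (directSum Ls) + disagree f L′)
directSum-equal-or-far {m} {d} f Ls L′ (Ls′ , L′≗) with affine-zero-or-heavy d (λ i v → Ls i v xor Ls′ i v) false
... | inj₁ vanishes = inj₁ λ x → sym (xor≡false⇒≡ (trans (cong (L x xor_) (L′≗ x))
                                                (trans (directSum-xor Ls Ls′ x) (vanishes x))))
  where L = directSum Ls
... | inj₂ heavy = inj₂ (≤-trans heavy (*-monoʳ-≤ (suc m) (begin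
  weight (λ x → directSum (λ i v → Ls i v xor Ls′ i v) x)
    ≡⟨ ∑-cong (λ x → cong indicator (trans (sym (directSum-xor Ls Ls′ x)) (cong (L x xor_) (sym (L′≗ x)))))
              (allPoints (suc m) d) ⟩
  weight (λ x → L x xor L′ x)
    ≤⟨ ∑-mono-≤ (λ x → indicator-xor-triangle (f x) (L x) (L′ x)) (allPoints (suc m) d) ⟩
  ∑[ x ← allPoints (suc m) d ] (indicator (f x xor L x) + indicator (f x xor L′ x))
    ≡⟨ ∑-distrib-+ (allPoints (suc m) d) _ _ ⟩
  weight (λ x → f x xor L x) + weight (λ x → f x xor L′ x)
    ≡⟨ sym (cong₂ _+_ (disagree≡weight f L) (disagree≡weight f L′)) ⟩
  disagree f L + disagree f L′ ∎)))
  where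
  open ≤-Reasoning
  L = directSum Ls

directSum-uniqueClosest : ∀ {m d} (f : BFun (suc m) d) (Ls : Fin d → Fin (suc m) → Bool) (B : ℕ) →
  disagree f (directSum Ls) ≤ B → suc m * (B + B) < suc m ^ d →
  IsUniqueClosestDirectSum f (directSum Ls)
directSum-uniqueClosest {m} {d} f Ls B dist≤B 2nB<n^d = (isDirectSum , closest) , unique
  where
  n = suc m
  L = directSum Ls
  isDirectSum : IsDirectSum L
  isDirectSum = Ls , λ _ → refl

  far⇒B<dist : ∀ {L′} → n ^ d ≤ n * (disagree f L + disagree f L′) → B < disagree f L′
  far⇒B<dist {L′} far = +-cancelˡ-< B B (disagree f L′) (*-cancelˡ-< n (B + B) (B + disagree f L′)
    (<-≤-trans 2nB<n^d (≤-trans far (*-monoʳ-≤ n (+-monoˡ-≤ (disagree f L′) dist≤B)))))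

  closest : ∀ L′ → IsDirectSum L′ → disagree f L ≤ disagree f L′
  closest L′ isDS′ with directSum-equal-or-far f Ls L′ isDS′
  ... | inj₁ L′≗L = ≤-reflexive (disagree-cong f (λ x → sym (L′≗L x)))
  ... | inj₂ far  = ≤-trans dist≤B (<⇒≤ (far⇒B<dist far))

  unique : ∀ L′ → IsClosestDirectSum f L′ → ∀ x → L′ x ≡ L x
  unique L′ (isDS′ , closest′) with directSum-equal-or-far f Ls L′ isDS′
  ... | inj₁ L′≗L = L′≗L
  ... | inj₂ far  = ⊥-elim (<-irrefl refl (<-≤-trans (far⇒B<dist far) (≤-trans (closest′ L isDirectSum) dist≤B)))

^-distribʳ-* : ∀ a b k → (a * b) ^ k ≡ a ^ k * b ^ k
^-distribʳ-* a b zero    = refl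
^-distribʳ-* a b (suc k) = trans (cong (a * b *_) (^-distribʳ-* a b k)) (interchange a b (a ^ k) (b ^ k))
  where
  interchange : ∀ a b x y → a * b * (x * y) ≡ a * x * (b * y)
  interchange = solve-∀

^-comm : ∀ a k l → (a ^ k) ^ l ≡ (a ^ l) ^ k
^-comm a k l = trans (^-*-assoc a k l) (trans (cong (a ^_) (*-comm k l)) (sym (^-*-assoc a l k)))

^-cancelʳ-< : ∀ k {a b} → a ^ k < b ^ k → a < b
^-cancelʳ-< k aᵏ<bᵏ = ≰⇒> λ b≤a → <⇒≱ aᵏ<bᵏ (^-monoˡ-≤ k b≤a)

-- (1 + 1/n)^k · (n + 1 - k) ≤ n + 1, cleared of denominators.
bernoulli : ∀ n k j → k + j ≡ suc n → suc n ^ k * j ≤ n ^ k * suc n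
bernoulli n zero    j k+j≡1+n = ≤-reflexive (cong (1 *_) k+j≡1+n)
bernoulli n (suc k) j k+j≡1+n = begin
  suc n * suc n ^ k * j      ≡⟨ shuffle (suc n) (suc n ^ k) j ⟩
  suc n ^ k * (suc n * j)    ≤⟨ *-monoʳ-≤ (suc n ^ k) step ⟩
  suc n ^ k * (n * suc j)    ≡⟨ shuffle′ (suc n ^ k) n (suc j) ⟩
  n * (suc n ^ k * suc j)    ≤⟨ *-monoʳ-≤ n (bernoulli n k (suc j) (trans (+-suc k j) k+j≡1+n)) ⟩
  n * (n ^ k * suc n)        ≡⟨ sym (*-assoc n (n ^ k) (suc n)) ⟩
  n * n ^ k * suc n          ∎
  where
  open ≤-Reasoning
  shuffle : ∀ a b c → a * b * c ≡ b * (a * c)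
  shuffle = solve-∀
  shuffle′ : ∀ a b c → a * (b * c) ≡ b * (a * c)
  shuffle′ = solve-∀
  j≤n : j ≤ n
  j≤n = ≤-pred (≤-trans (s≤s (m≤n+m j k)) (≤-reflexive k+j≡1+n))
  step : suc n * j ≤ n * suc j
  step = begin
    suc n * j   ≡⟨ +-comm j (n * j) ⟩
    n * j + j   ≤⟨ +-monoʳ-≤ (n * j) j≤n ⟩
    n * j + n   ≡⟨ +-comm (n * j) n ⟩
    n + n * j   ≡⟨ sym (*-suc n j) ⟩
    n * suc j   ∎

-- For even n = 2h, apply the Bernoulli bound to each half of the exponent: (1 + 1/n)^h < 2.
[1+n]^n≤4*n^n : ∀ h → let n = 2 * h in suc n ^ n ≤ 4 * n ^ n
[1+n]^n≤4*n^n h = begin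
  suc n ^ (2 * h)              ≡⟨ cong (suc n ^_) (double h) ⟩
  suc n ^ (h + h)              ≡⟨ ^-distribˡ-+-* (suc n) h h ⟩
  suc n ^ h * suc n ^ h        ≤⟨ *-mono-≤ half half ⟩
  (2 * n ^ h) * (2 * n ^ h)    ≡⟨ four (n ^ h) ⟩
  4 * (n ^ h * n ^ h)          ≡⟨ cong (4 *_) (sym (^-distribˡ-+-* n h h)) ⟩
  4 * n ^ (h + h)              ≡⟨ cong (λ e → 4 * n ^ e) (sym (double h)) ⟩
  4 * n ^ (2 * h)              ∎
  where
  open ≤-Reasoning
  n = 2 * h
  double : ∀ h → 2 * h ≡ h + h
  double = solve-∀
  four : ∀ x → (2 * x) * (2 * x) ≡ 4 * (x * x)
  four = solve-∀
  h+[1+h]≡1+n : ∀ h → h + suc h ≡ suc (2 * h)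
  h+[1+h]≡1+n = solve-∀
  2+n≡2*[1+h] : ∀ h → suc (suc (2 * h)) ≡ 2 * suc h
  2+n≡2*[1+h] = solve-∀
  half : suc n ^ h ≤ 2 * n ^ h
  half = *-cancelʳ-≤ (suc n ^ h) (2 * n ^ h) (suc n) (begin
    suc n ^ h * suc n          ≤⟨ *-monoʳ-≤ (suc n ^ h) (≤-trans (n≤1+n (suc n)) (≤-reflexive (2+n≡2*[1+h] h))) ⟩
    suc n ^ h * (2 * suc h)    ≡⟨ *-comm (suc n ^ h) (2 * suc h) ⟩
    2 * suc h * suc n ^ h      ≡⟨ *-assoc 2 (suc h) (suc n ^ h) ⟩
    2 * (suc h * suc n ^ h)    ≡⟨ cong (2 *_) (*-comm (suc h) (suc n ^ h)) ⟩
    2 * (suc n ^ h * suc h)    ≤⟨ *-monoʳ-≤ 2 (bernoulli n h (suc h) (h+[1+h]≡1+n h)) ⟩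
    2 * (n ^ h * suc n)        ≡⟨ sym (*-assoc 2 (n ^ h) (suc n)) ⟩
    2 * n ^ h * suc n          ∎)

isOne : ∀ {n} → Fin n → Bool
isOne zero    = true
isOne (suc _) = false

ones : ∀ {n d} → Point n d → ℕ
ones []       = 0
ones (v ∷ xs) = indicator (isOne v) + ones xs

ones≡∑ : ∀ {n k} (x : Point n k) → ∑[ i ← allFin k ] indicator (isOne (lookup x i)) ≡ ones x
ones≡∑ []              = refl
ones≡∑ {k = suc k} (v ∷ x) =
  trans (∑-allFin-suc k (λ i → indicator (isOne (lookup (v ∷ x) i)))) (cong (_+_ (indicator (isOne v))) (ones≡∑ x))

-- Each coordinate contributes 2 + (n - 1): the value 1 has weight 2, every other value weight 1.
∑-2^ones : ∀ m d → ∑[ x ← allPoints (suc m) d ] 2 ^ ones x ≡ suc (suc m) ^ d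
∑-2^ones m zero    = refl
∑-2^ones m (suc d) = begin
  ∑[ x ← allPoints n (suc d) ] 2 ^ ones x
    ≡⟨ ∑-allPoints-suc n d (λ x → 2 ^ ones x) ⟩
  ∑[ i ← allFin n ] ∑[ xs ← allPoints n d ] 2 ^ (indicator (isOne i) + ones xs)
    ≡⟨ ∑-cong (λ i → trans (∑-cong (λ xs → ^-distribˡ-+-* 2 (indicator (isOne i)) (ones xs)) (allPoints n d))
                           (∑-*ˡ (allPoints n d) (2 ^ indicator (isOne i)) (λ xs → 2 ^ ones xs))) (allFin n) ⟩
  ∑[ i ← allFin n ] 2 ^ indicator (isOne i) * (∑[ xs ← allPoints n d ] 2 ^ ones xs)
    ≡⟨ ∑-*ʳ (allFin n) _ (λ i → 2 ^ indicator (isOne i)) ⟩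
  (∑[ i ← allFin n ] 2 ^ indicator (isOne i)) * (∑[ xs ← allPoints n d ] 2 ^ ones xs)
    ≡⟨ cong₂ _*_ coordinate (∑-2^ones m d) ⟩
  suc n * suc n ^ d ∎
  where
  open ≡-Reasoning
  n = suc m
  coordinate : ∑[ i ← allFin n ] 2 ^ indicator (isOne i) ≡ suc n
  coordinate = trans (∑-allFin-suc m (λ i → 2 ^ indicator (isOne i)))
    (cong (_+_ 2) (trans (∑-const (allFin m) 1) (trans (*-identityʳ _) (length-tabulate {n = m} id))))

-- Markov's inequality for the weights 2^(ones x).
manyOnes-count : ∀ m d k → (∑[ x ← allPoints (suc m) d ] indicator (k ≤ᵇ ones x)) * 2 ^ k ≤ suc (suc m) ^ d
manyOnes-count m d k = begin
  (∑[ x ← allPoints (suc m) d ] indicator (k ≤ᵇ ones x)) * 2 ^ k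
    ≡⟨ sym (∑-*ʳ (allPoints (suc m) d) (2 ^ k) (λ x → indicator (k ≤ᵇ ones x))) ⟩
  ∑[ x ← allPoints (suc m) d ] indicator (k ≤ᵇ ones x) * 2 ^ k
    ≤⟨ ∑-mono-≤ pointwise (allPoints (suc m) d) ⟩
  ∑[ x ← allPoints (suc m) d ] 2 ^ ones x
    ≡⟨ ∑-2^ones m d ⟩
  suc (suc m) ^ d ∎
  where
  open ≤-Reasoning
  pointwise : (x : Point (suc m) d) → indicator (k ≤ᵇ ones x) * 2 ^ k ≤ 2 ^ ones x
  pointwise x with k ≤ᵇ ones x in k≤ᵇones
  ... | false = z≤n
  ... | true  = ≤-trans (≤-reflexive (+-identityʳ (2 ^ k)))
                  (^-monoʳ-≤ 2 (≤ᵇ⇒≤ k (ones x) (subst T (sym k≤ᵇones) tt)))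

-- The bound is proved after raising both sides to the n-th power, where the hypotheses apply.
n*[X+X]<n^d : ∀ m d X z → let n = suc m in
  7 ^ d * (2 * n) ^ n < 10 ^ d → suc n ^ n ≤ 4 * n ^ n →
  X * 2 ^ z ≤ suc n ^ d → 4 * d < z * n → n * (X + X) < n ^ d
n*[X+X]<n^d m d X z 7ᵈ[2n]ⁿ<10ᵈ [1+n]ⁿ≤4nⁿ X2ᶻ≤[1+n]ᵈ 4d<zn =
  ^-cancelʳ-< n (*-cancelʳ-< (16 ^ d) (Y ^ n) ((n ^ d) ^ n) (begin-strict
    Y ^ n * 16 ^ d                        ≤⟨ *-monoʳ-≤ (Y ^ n) 16ᵈ≤[2ᶻ]ⁿ ⟩
    Y ^ n * (2 ^ z) ^ n                   ≡⟨ sym (^-distribʳ-* Y (2 ^ z) n) ⟩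
    (Y * 2 ^ z) ^ n                       ≡⟨ cong (_^ n) (regroup n X (2 ^ z)) ⟩
    (2 * n * (X * 2 ^ z)) ^ n             ≡⟨ ^-distribʳ-* (2 * n) (X * 2 ^ z) n ⟩
    (2 * n) ^ n * (X * 2 ^ z) ^ n         ≤⟨ *-monoʳ-≤ ((2 * n) ^ n) (^-monoˡ-≤ n X2ᶻ≤[1+n]ᵈ) ⟩
    (2 * n) ^ n * (suc n ^ d) ^ n         ≡⟨ cong ((2 * n) ^ n *_) (^-comm (suc n) d n) ⟩
    (2 * n) ^ n * (suc n ^ n) ^ d         ≤⟨ *-monoʳ-≤ ((2 * n) ^ n) (^-monoˡ-≤ d [1+n]ⁿ≤4nⁿ) ⟩
    (2 * n) ^ n * (4 * n ^ n) ^ d         ≡⟨ cong ((2 * n) ^ n *_) (^-distribʳ-* 4 (n ^ n) d) ⟩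
    (2 * n) ^ n * (4 ^ d * (n ^ n) ^ d)   ≡⟨ sym (*-assoc ((2 * n) ^ n) (4 ^ d) _) ⟩
    (2 * n) ^ n * 4 ^ d * (n ^ n) ^ d     <⟨ *-monoˡ-< ((n ^ n) ^ d) {{m^n≢0 (n ^ n) d {{m^n≢0 n n}}}} [2n]ⁿ4ᵈ<16ᵈ ⟩
    16 ^ d * (n ^ n) ^ d                  ≡⟨ cong (16 ^ d *_) (^-comm n n d) ⟩
    16 ^ d * (n ^ d) ^ n                  ≡⟨ *-comm (16 ^ d) _ ⟩
    (n ^ d) ^ n * 16 ^ d                  ∎))
  where
  open ≤-Reasoning
  n = suc m
  Y = n * (X + X)
  regroup : ∀ n X w → n * (X + X) * w ≡ 2 * n * (X * w)
  regroup = solve-∀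
  16ᵈ≤[2ᶻ]ⁿ : 16 ^ d ≤ (2 ^ z) ^ n
  16ᵈ≤[2ᶻ]ⁿ = begin
    16 ^ d        ≡⟨ ^-*-assoc 2 4 d ⟩
    2 ^ (4 * d)   ≤⟨ ^-monoʳ-≤ 2 (<⇒≤ 4d<zn) ⟩
    2 ^ (z * n)   ≡⟨ sym (^-*-assoc 2 z n) ⟩
    (2 ^ z) ^ n   ∎
  [2n]ⁿ4ᵈ<16ᵈ : (2 * n) ^ n * 4 ^ d < 16 ^ d
  [2n]ⁿ4ᵈ<16ᵈ = *-cancelˡ-< (7 ^ d) _ _ (begin-strict
    7 ^ d * ((2 * n) ^ n * 4 ^ d)   ≡⟨ sym (*-assoc (7 ^ d) _ _) ⟩
    7 ^ d * (2 * n) ^ n * 4 ^ d     <⟨ *-monoˡ-< (4 ^ d) {{m^n≢0 4 d}} 7ᵈ[2n]ⁿ<10ᵈ ⟩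
    10 ^ d * 4 ^ d                  ≡⟨ sym (^-distribʳ-* 10 4 d) ⟩
    40 ^ d                          ≤⟨ ^-monoˡ-≤ d (≤ᵇ⇒≤ 40 112 tt) ⟩
    112 ^ d                         ≡⟨ ^-distribʳ-* 7 16 d ⟩
    7 ^ d * 16 ^ d                  ∎)

^ℚ-distribʳ-*ℚ : (a b : ℚ) (k : ℕ) → (a *ℚ b) ^ℚ k ≡ (a ^ℚ k) *ℚ (b ^ℚ k)
^ℚ-distribʳ-*ℚ a b zero    = refl
^ℚ-distribʳ-*ℚ a b (suc k) =
  trans (cong ((a *ℚ b) *ℚ_) (^ℚ-distribʳ-*ℚ a b k)) (*ℚ-interchange a b (a ^ℚ k) (b ^ℚ k))

^ℚ-pos : (a : ℚ) → 0ℚ <ℚ a → (k : ℕ) → 0ℚ <ℚ a ^ℚ k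
^ℚ-pos a 0<a zero    = ℚ.positive⁻¹ 1ℚ
^ℚ-pos a 0<a (suc k) =
  ℚ.positive⁻¹ _ {{ℚ.pos*pos⇒pos a {{positive 0<a}} (a ^ℚ k) {{positive (^ℚ-pos a 0<a k)}}}}

^ℚ-nonNeg : (a : ℚ) → 0ℚ ≤ℚ a → (k : ℕ) → 0ℚ ≤ℚ a ^ℚ k
^ℚ-nonNeg a 0≤a zero    = ℚ.nonNegative⁻¹ 1ℚ
^ℚ-nonNeg a 0≤a (suc k) = ℚ.nonNegative⁻¹ _
  {{ℚ.nonNeg*nonNeg⇒nonNeg a {{nonNegative 0≤a}} (a ^ℚ k) {{nonNegative (^ℚ-nonNeg a 0≤a k)}}}}

^ℚ-monoˡ-≤ : (a b : ℚ) → 0ℚ ≤ℚ a → a ≤ℚ b → (k : ℕ) → a ^ℚ k ≤ℚ b ^ℚ k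
^ℚ-monoˡ-≤ a b 0≤a a≤b zero    = ℚ.≤-refl
^ℚ-monoˡ-≤ a b 0≤a a≤b (suc k) = ℚ.≤-trans
  (ℚ.*-monoˡ-≤-nonNeg a {{nonNegative 0≤a}} (^ℚ-monoˡ-≤ a b 0≤a a≤b k))
  (ℚ.*-monoʳ-≤-nonNeg (b ^ℚ k) {{nonNegative (^ℚ-nonNeg b (ℚ.≤-trans 0≤a a≤b) k)}} a≤b)

1ℚ^ℚk≡1ℚ : (k : ℕ) → 1ℚ ^ℚ k ≡ 1ℚ
1ℚ^ℚk≡1ℚ zero    = refl
1ℚ^ℚk≡1ℚ (suc k) = cong (1ℚ *ℚ_) (1ℚ^ℚk≡1ℚ k)

/1-normal : (a : ℕ) → + a / 1 ≡ mkℚ (+ a) 0 (Coprime.sym (Coprime.1-coprimeTo a))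
/1-normal a = ℚ.normalize-coprime (Coprime.sym (Coprime.1-coprimeTo a))

/1-homo-* : (a b : ℕ) → (+ a / 1) *ℚ (+ b / 1) ≡ + (a * b) / 1
/1-homo-* a b rewrite /1-normal a | /1-normal b = cong (_/ 1) (sym (ℤ.pos-* a b))

/1-homo-^ : (a k : ℕ) → (+ a / 1) ^ℚ k ≡ + (a ^ k) / 1
/1-homo-^ a zero    = refl
/1-homo-^ a (suc k) = trans (cong ((+ a / 1) *ℚ_) (/1-homo-^ a k)) (/1-homo-* a (a ^ k))

/1-cancel-< : (a b : ℕ) → + a / 1 <ℚ + b / 1 → a < b
/1-cancel-< a b a<b rewrite /1-normal a | /1-normal b with a<b
... | *<* a*1<b*1 rewrite ℤ.*-identityʳ (+ a) | ℤ.*-identityʳ (+ b) = ℤ.drop‿+<+ a*1<b*1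

-- Multiply (7/10)^d · n^n < (nε)^n < (1/2)^n by 10^d · 2^n to clear all denominators.
7ᵈ[2n]ⁿ<10ᵈ : (m d : ℕ) (ε : ℚ) → 0ℚ <ℚ ε → (+ 7 / 10) ^ℚ d <ℚ ε ^ℚ suc m →
              (+ suc m / 1) *ℚ ε <ℚ ½ → 7 ^ d * (2 * suc m) ^ suc m < 10 ^ d
7ᵈ[2n]ⁿ<10ᵈ m d ε 0<ε [7/10]ᵈ<εⁿ nε<½ = /1-cancel-< _ _ (subst₂ _<ℚ_ lhs rhs scaled)
  where
  n = suc m
  c = + n / 1
  a = (+ 7 / 10) ^ℚ d
  K = ((+ 10 / 1) ^ℚ d) *ℚ ((+ 2 / 1) ^ℚ n)

  0<c : 0ℚ <ℚ c
  0<c = ℚ.positive⁻¹ c {{ℚ.normalize-pos n 1}}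
  0≤cε : 0ℚ ≤ℚ c *ℚ ε
  0≤cε = ℚ.<⇒≤ (ℚ.positive⁻¹ (c *ℚ ε) {{ℚ.pos*pos⇒pos c {{positive 0<c}} ε {{positive 0<ε}}}})
  0<K : 0ℚ <ℚ K
  0<K = ℚ.positive⁻¹ K {{ℚ.pos*pos⇒pos ((+ 10 / 1) ^ℚ d) {{positive (^ℚ-pos (+ 10 / 1) (ℚ.positive⁻¹ _) d)}}
                                       ((+ 2 / 1) ^ℚ n) {{positive (^ℚ-pos (+ 2 / 1) (ℚ.positive⁻¹ _) n)}}}}

  below-½ⁿ : a *ℚ (c ^ℚ n) <ℚ ½ ^ℚ n
  below-½ⁿ = ℚ.<-≤-trans
    (subst (a *ℚ (c ^ℚ n) <ℚ_) (trans (ℚ.*-comm (ε ^ℚ n) (c ^ℚ n)) (sym (^ℚ-distribʳ-*ℚ c ε n)))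
           (ℚ.*-monoˡ-<-pos (c ^ℚ n) {{positive (^ℚ-pos c 0<c n)}} [7/10]ᵈ<εⁿ))
    (^ℚ-monoˡ-≤ (c *ℚ ε) ½ 0≤cε (ℚ.<⇒≤ nε<½) n)
  scaled : (a *ℚ (c ^ℚ n)) *ℚ K <ℚ (½ ^ℚ n) *ℚ K
  scaled = ℚ.*-monoˡ-<-pos K {{positive 0<K}} below-½ⁿ

  lhs : (a *ℚ (c ^ℚ n)) *ℚ K ≡ + (7 ^ d * (2 * n) ^ n) / 1
  lhs = begin
    (a *ℚ (c ^ℚ n)) *ℚ K
      ≡⟨ *ℚ-interchange a (c ^ℚ n) ((+ 10 / 1) ^ℚ d) ((+ 2 / 1) ^ℚ n) ⟩
    (a *ℚ ((+ 10 / 1) ^ℚ d)) *ℚ ((c ^ℚ n) *ℚ ((+ 2 / 1) ^ℚ n))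
      ≡⟨ cong₂ _*ℚ_ (sym (^ℚ-distribʳ-*ℚ (+ 7 / 10) (+ 10 / 1) d)) (sym (^ℚ-distribʳ-*ℚ c (+ 2 / 1) n)) ⟩
    ((+ 7 / 1) ^ℚ d) *ℚ ((c *ℚ (+ 2 / 1)) ^ℚ n)
      ≡⟨ cong (λ x → ((+ 7 / 1) ^ℚ d) *ℚ (x ^ℚ n)) (trans (/1-homo-* n 2) (cong (λ k → + k / 1) (*-comm n 2))) ⟩
    ((+ 7 / 1) ^ℚ d) *ℚ ((+ (2 * n) / 1) ^ℚ n)
      ≡⟨ cong₂ _*ℚ_ (/1-homo-^ 7 d) (/1-homo-^ (2 * n) n) ⟩
    (+ (7 ^ d) / 1) *ℚ (+ ((2 * n) ^ n) / 1)
      ≡⟨ /1-homo-* (7 ^ d) ((2 * n) ^ n) ⟩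
    + (7 ^ d * (2 * n) ^ n) / 1 ∎
    where open ≡-Reasoning

  rhs : (½ ^ℚ n) *ℚ K ≡ + (10 ^ d) / 1
  rhs = begin
    (½ ^ℚ n) *ℚ K                                         ≡⟨ ℚ.*-comm (½ ^ℚ n) K ⟩
    K *ℚ (½ ^ℚ n)                                         ≡⟨ ℚ.*-assoc ((+ 10 / 1) ^ℚ d) _ _ ⟩
    ((+ 10 / 1) ^ℚ d) *ℚ (((+ 2 / 1) ^ℚ n) *ℚ (½ ^ℚ n))  ≡⟨ cong (((+ 10 / 1) ^ℚ d) *ℚ_) (sym (^ℚ-distribʳ-*ℚ (+ 2 / 1) ½ n)) ⟩
    ((+ 10 / 1) ^ℚ d) *ℚ (1ℚ ^ℚ n)                        ≡⟨ cong (((+ 10 / 1) ^ℚ d) *ℚ_) (1ℚ^ℚk≡1ℚ n) ⟩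
    ((+ 10 / 1) ^ℚ d) *ℚ 1ℚ                               ≡⟨ ℚ.*-identityʳ _ ⟩
    (+ 10 / 1) ^ℚ d                                       ≡⟨ /1-homo-^ 10 d ⟩
    + (10 ^ d) / 1                                        ∎
    where open ≡-Reasoning

-- Double counting: an involution permutes a list in which every element occurs exactly once.
module _ {A : Set} (_≟_ : DecidableEquality A) (xs : List A)
         (occursOnce : ∀ a → ∑[ x ← xs ] indicator (does (x ≟ a)) ≡ 1) where

  ∑-select : (h : A → ℕ) (a : A) → ∑[ x ← xs ] indicator (does (x ≟ a)) * h x ≡ h a
  ∑-select h a = begin
    ∑[ x ← xs ] indicator (does (x ≟ a)) * h x   ≡⟨ ∑-cong pointwise xs ⟩
    ∑[ x ← xs ] indicator (does (x ≟ a)) * h a   ≡⟨ ∑-*ʳ xs (h a) (λ x → indicator (does (x ≟ a))) ⟩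
    (∑[ x ← xs ] indicator (does (x ≟ a))) * h a ≡⟨ cong (_* h a) (occursOnce a) ⟩
    1 * h a                                      ≡⟨ *-identityˡ (h a) ⟩
    h a                                          ∎
    where
    open ≡-Reasoning
    pointwise : ∀ x → indicator (does (x ≟ a)) * h x ≡ indicator (does (x ≟ a)) * h a
    pointwise x with x ≟ a
    ... | yes refl = refl
    ... | no  _    = refl

  ∑-involution : (σ : A → A) → (∀ x → σ (σ x) ≡ x) → (h : A → ℕ) → ∑[ x ← xs ] h (σ x) ≡ ∑ xs h
  ∑-involution σ σσ h = begin
    ∑[ x ← xs ] h (σ x)
      ≡⟨ ∑-cong (λ x → sym (∑-select h (σ x))) xs ⟩
    ∑[ x ← xs ] ∑[ y ← xs ] indicator (does (y ≟ σ x)) * h y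
      ≡⟨ ∑-comm xs xs _ ⟩
    ∑[ y ← xs ] ∑[ x ← xs ] indicator (does (y ≟ σ x)) * h y
      ≡⟨ ∑-cong (λ y → ∑-cong (λ x → cong (λ b → indicator b * h y) (transpose x y)) xs) xs ⟩
    ∑[ y ← xs ] ∑[ x ← xs ] indicator (does (x ≟ σ y)) * h y
      ≡⟨ ∑-cong (λ y → ∑-select (λ _ → h y) (σ y)) xs ⟩
    ∑ xs h ∎
    where
    open ≡-Reasoning
    transpose : ∀ x y → does (y ≟ σ x) ≡ does (x ≟ σ y)
    transpose x y with y ≟ σ x | x ≟ σ y
    ... | yes _    | yes _    = refl
    ... | no  _    | no  _    = refl
    ... | yes refl | no  x≢σy = ⊥-elim (x≢σy (sym (σσ x)))
    ... | no  y≢σx | yes refl = ⊥-elim (y≢σx (sym (σσ y)))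

allBits : ∀ k → List (Vec Bool k)
allBits zero    = [] ∷ []
allBits (suc k) = map (true ∷_) (allBits k) ++ map (false ∷_) (allBits k)

_≟ᵛ_ : ∀ {k} → DecidableEquality (Vec Bool k)
_≟ᵛ_ = Vec.≡-dec Bool._≟_

allBits-occursOnce : ∀ k (a : Vec Bool k) → ∑[ c ← allBits k ] indicator (does (c ≟ᵛ a)) ≡ 1
allBits-occursOnce zero    []      = refl
allBits-occursOnce (suc k) (b ∷ a) = begin
  ∑[ c ← allBits (suc k) ] indicator (does (c ≟ᵛ (b ∷ a)))
    ≡⟨ ∑-++ (map (true ∷_) (allBits k)) _ _ ⟩
  (∑[ c ← map (true ∷_) (allBits k) ] indicator (does (c ≟ᵛ (b ∷ a))))
    + (∑[ c ← map (false ∷_) (allBits k) ] indicator (does (c ≟ᵛ (b ∷ a))))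
    ≡⟨ cong₂ _+_ (∑-map (true ∷_) (allBits k) _) (∑-map (false ∷_) (allBits k) _) ⟩
  (∑[ c ← allBits k ] indicator (does (true Bool.≟ b) ∧ does (c ≟ᵛ a)))
    + (∑[ c ← allBits k ] indicator (does (false Bool.≟ b) ∧ does (c ≟ᵛ a)))
    ≡⟨ byHead b ⟩
  1 ∎
  where
  open ≡-Reasoning
  byHead : ∀ b → (∑[ c ← allBits k ] indicator (does (true Bool.≟ b) ∧ does (c ≟ᵛ a)))
               + (∑[ c ← allBits k ] indicator (does (false Bool.≟ b) ∧ does (c ≟ᵛ a))) ≡ 1
  byHead true  = cong₂ _+_ (allBits-occursOnce k a) (∑-zero (allBits k))
  byHead false = cong₂ _+_ (∑-zero (allBits k)) (allBits-occursOnce k a)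

length-allBits : ∀ k → length (allBits k) ≡ 2 ^ k
length-allBits zero    = refl
length-allBits (suc k) = begin
  length (map (true ∷_) (allBits k) ++ map (false ∷_) (allBits k))
    ≡⟨ length-++ (map (true ∷_) (allBits k)) ⟩
  length (map (true ∷_) (allBits k)) + length (map (false ∷_) (allBits k))
    ≡⟨ cong₂ _+_ (length-map (true ∷_) (allBits k)) (length-map (false ∷_) (allBits k)) ⟩
  length (allBits k) + length (allBits k)
    ≡⟨ cong (λ l → l + l) (length-allBits k) ⟩
  2 ^ k + 2 ^ k
    ≡⟨ cong (_+_ (2 ^ k)) (sym (+-identityʳ (2 ^ k))) ⟩
  2 * 2 ^ k ∎
  where open ≡-Reasoning

flip : ∀ {k} → Vec Bool k → Fin k → Vec Bool k
flip c i = updateAt c i not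

flip-involutive : ∀ {k} (c : Vec Bool k) i → flip (flip c i) i ≡ c
flip-involutive c i = trans (Vec.updateAt-updateAt i c)
  (trans (Vec.updateAt-cong i Bool.not-involutive c) (Vec.updateAt-id i c))

path : ∀ {n d} → DTree n d → BFun n d → List (Point n d)
path (leaf _)    f = []
path (query x k) f = x ∷ path (k (f x)) f

length-path : ∀ {n d} (t : DTree n d) f → length (path t f) ≡ queries t f
length-path (leaf _)    f = refl
length-path (query x k) f = cong suc (length-path (k (f x)) f)

agreeOnPath⇒sameRun : ∀ {n d} (t : DTree n d) (f g : BFun n d) → All (λ x → f x ≡ g x) (path t f) →
                      run t f ≡ run t g × path t f ≡ path t g
agreeOnPath⇒sameRun (leaf _)    f g []                   = refl , refl
agreeOnPath⇒sameRun (query x k) f g (fx≡gx ∷ agreeRest) rewrite fx≡gx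
  with agreeOnPath⇒sameRun (k (g x)) f g agreeRest
... | sameRun , samePath = sameRun , cong (x ∷_) samePath

indicatorSum : ∀ {n k} → Vec Bool k → BFun n k
indicatorSum c = directSum (λ i v → lookup c i ∧ isOne v)

indicatorSum-flip-one : ∀ {m k} (c : Vec Bool k) i →
  indicatorSum {suc m} (flip c i) (one k) ≡ not (indicatorSum {suc m} c (one k))
indicatorSum-flip-one     (true  ∷ c) zero    = sym (Bool.not-involutive _)
indicatorSum-flip-one     (false ∷ c) zero    = refl
indicatorSum-flip-one {m} (true  ∷ c) (suc i) = cong not (indicatorSum-flip-one {m} c i)
indicatorSum-flip-one {m} (false ∷ c) (suc i) = indicatorSum-flip-one {m} c i

successes-map : ∀ {m d} (t : DTree (suc m) d) (g : Vec Bool d → BFun (suc m) d × BFun (suc m) d) cs →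
  successes t (map g cs) ≡ ∑[ c ← cs ] indicator ⌊ run t (proj₁ (g c)) Bool.≟ proj₂ (g c) (one d) ⌋
successes-map t g []       = refl
successes-map t g (c ∷ cs) = cong (_+_ _) (successes-map t g cs)

module HardInstance (m d′ : ℕ) where
  n d q threshold : ℕ
  n = suc m
  d = suc d′
  q = 4 * d ℕ./ n
  threshold = suc q

  q*n≤4d : q * n ≤ 4 * d
  q*n≤4d = begin
    q * n               ≤⟨ m≤n+m (q * n) (4 * d % n) ⟩
    4 * d % n + q * n   ≡⟨ sym (m≡m%n+[m/n]*n (4 * d) n) ⟩
    4 * d               ∎
    where open ≤-Reasoning

  4d<threshold*n : 4 * d < threshold * n
  4d<threshold*n = begin-strict
    4 * d               ≡⟨ m≡m%n+[m/n]*n (4 * d) n ⟩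
    4 * d % n + q * n   <⟨ +-monoˡ-< (q * n) (m%n<n (4 * d) n) ⟩
    n + q * n           ∎
    where open ≤-Reasoning

  exceptional : Point n d → Bool
  exceptional x = threshold ≤ᵇ ones x

  #exceptional : ℕ
  #exceptional = ∑[ x ← allPoints n d ] indicator (exceptional x)

  masked : Vec Bool d → BFun n d
  masked c x = if exceptional x then false else indicatorSum c x

  instances : List (BFun n d × BFun n d)
  instances = map (λ c → masked c , indicatorSum c) (allBits d)

  disagree-masked≤#exceptional : ∀ c → disagree (masked c) (indicatorSum c) ≤ #exceptional
  disagree-masked≤#exceptional c =
    ≤-trans (≤-reflexive (disagree≡weight (masked c) (indicatorSum c))) (∑-mono-≤ pointwise (allPoints n d))
    where
    pointwise : ∀ x → indicator (masked c x xor indicatorSum c x) ≤ indicator (exceptional x)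
    pointwise x with exceptional x
    ... | true  = indicator-≤1 (indicatorSum c x)
      where
      indicator-≤1 : ∀ b → indicator (false xor b) ≤ 1
      indicator-≤1 false = z≤n
      indicator-≤1 true  = s≤s z≤n
    ... | false = ≤-reflexive (cong indicator (Bool.xor-same (indicatorSum c x)))

  reveals : Point n d → Fin d → Bool
  reveals p i = not (exceptional p) ∧ isOne (lookup p i)

  ∑-reveals≤q : ∀ p → ∑[ i ← allFin d ] indicator (reveals p i) ≤ q
  ∑-reveals≤q p with exceptional p in exceptional≡
  ... | true  = ≤-trans (≤-reflexive (∑-zero (allFin d))) z≤n
  ... | false = ≤-trans (≤-reflexive (ones≡∑ p)) (≤-pred (≰⇒> λ threshold≤ones →
                  subst T exceptional≡ (≤⇒≤ᵇ threshold≤ones)))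

  unrevealed⇒masked-flip : ∀ c i p → reveals p i ≡ false → masked c p ≡ masked (flip c i) p
  unrevealed⇒masked-flip c i p unrevealed with exceptional p
  ... | true  = refl
  ... | false = directSum-cong _ _ p sameCoordinate
    where
    sameCoordinate : ∀ j → lookup c j ∧ isOne (lookup p j) ≡ lookup (flip c i) j ∧ isOne (lookup p j)
    sameCoordinate j with j Fin.≟ i
    ... | yes refl rewrite unrevealed = trans (Bool.∧-zeroʳ _) (sym (Bool.∧-zeroʳ _))
    ... | no  j≢i  = cong (_∧ isOne (lookup p j)) (sym (Vec.lookup∘updateAt′ j i j≢i c))

  revealCount : Fin d → List (Point n d) → ℕ
  revealCount i Q = ∑[ p ← Q ] indicator (reveals p i)

  d≤|Q|*q : ∀ Q → (∀ i → 1 ≤ revealCount i Q) → d ≤ length Q * q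
  d≤|Q|*q Q allRevealed = begin
    d                                                     ≡⟨ sym (length-tabulate {n = d} id) ⟩
    length (allFin d)                                     ≡⟨ length≡∑1 (allFin d) ⟩
    ∑[ _ ← allFin d ] 1                                   ≤⟨ ∑-mono-≤ allRevealed (allFin d) ⟩
    ∑[ i ← allFin d ] revealCount i Q                     ≡⟨ ∑-comm (allFin d) Q (λ i p → indicator (reveals p i)) ⟩
    ∑[ p ← Q ] ∑[ i ← allFin d ] indicator (reveals p i)  ≤⟨ ∑-mono-≤ ∑-reveals≤q Q ⟩
    ∑[ _ ← Q ] q                                          ≡⟨ ∑-const Q q ⟩
    length Q * q                                          ∎
    where open ≤-Reasoning

  firstUnrevealed : ∀ Q → Dec (∃ λ i → revealCount i Q ≡ 0) → Fin d
  firstUnrevealed Q (yes (i , _)) = i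
  firstUnrevealed Q (no _)        = zero

  unrevealed : List (Point n d) → Fin d
  unrevealed Q = firstUnrevealed Q (Fin.any? (λ i → revealCount i Q ≟ 0))

  revealCount-unrevealed : ∀ Q → 4 * length Q < n → revealCount (unrevealed Q) Q ≡ 0
  revealCount-unrevealed Q 4|Q|<n with Fin.any? (λ i → revealCount i Q ≟ 0)
  ... | yes (_ , count≡0) = count≡0
  ... | no  noneUnrevealed = ⊥-elim (<-irrefl refl (begin-strict
    n * d                   ≤⟨ *-monoʳ-≤ n (d≤|Q|*q Q (λ i → n≢0⇒n>0 λ count≡0 → noneUnrevealed (i , count≡0))) ⟩
    n * (length Q * q)      ≡⟨ regroup n (length Q) q ⟩
    length Q * (q * n)      ≤⟨ *-monoʳ-≤ (length Q) q*n≤4d ⟩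
    length Q * (4 * d)      ≡⟨ sym (*-assoc (length Q) 4 d) ⟩
    length Q * 4 * d        ≡⟨ cong (_* d) (*-comm (length Q) 4) ⟩
    4 * length Q * d        <⟨ *-monoˡ-< d 4|Q|<n ⟩
    n * d                   ∎))
    where
    open ≤-Reasoning
    regroup : ∀ a b c → a * (b * c) ≡ b * (c * a)
    regroup = solve-∀

  module _ (t : DTree n d) (fewQueries : ∀ f → 4 * queries t f < n) where

    σ : Vec Bool d → Vec Bool d
    σ c = flip c (unrevealed (path t (masked c)))

    σ-indistinguishable : ∀ c → run t (masked c) ≡ run t (masked (σ c))
                              × path t (masked c) ≡ path t (masked (σ c))
    σ-indistinguishable c = agreeOnPath⇒sameRun t (masked c) (masked (σ c))
      (All.map (λ {p} → unrevealed⇒masked-flip c i p ∘ indicator≡0⇒false)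
        (∑≡0⇒All≡0 Q (λ p → indicator (reveals p i)) (revealCount-unrevealed Q |Q|<n/4)))
      where
      Q = path t (masked c)
      i = unrevealed Q
      |Q|<n/4 : 4 * length Q < n
      |Q|<n/4 = subst (λ l → 4 * l < n) (sym (length-path t (masked c))) (fewQueries (masked c))
      indicator≡0⇒false : ∀ {b} → indicator b ≡ 0 → b ≡ false
      indicator≡0⇒false {false} _ = refl

    σ-involutive : ∀ c → σ (σ c) ≡ c
    σ-involutive c = trans
      (cong (λ Q → flip (σ c) (unrevealed Q)) (sym (proj₂ (σ-indistinguishable c))))
      (flip-involutive c (unrevealed (path t (masked c))))

    success : Vec Bool d → ℕ
    success c = indicator ⌊ run t (masked c) Bool.≟ indicatorSum {n} c (one d) ⌋

    success-σ : ∀ c → success (σ c) + success c ≡ 1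
    success-σ c = trans
      (cong (_+ success c) (cong₂ (λ r l → indicator ⌊ r Bool.≟ l ⌋)
        (sym (proj₁ (σ-indistinguishable c)))
        (indicatorSum-flip-one {m} c (unrevealed (path t (masked c))))))
      (exactlyOne (run t (masked c)) (indicatorSum {n} c (one d)))
      where
      exactlyOne : ∀ r l → indicator ⌊ r Bool.≟ not l ⌋ + indicator ⌊ r Bool.≟ l ⌋ ≡ 1
      exactlyOne false false = refl
      exactlyOne false true  = refl
      exactlyOne true  false = refl
      exactlyOne true  true  = refl

    halfSuccesses : 2 * successes t instances ≡ length instances
    halfSuccesses = begin
      2 * successes t instances                       ≡⟨ cong (2 *_) (successes-map t _ (allBits d)) ⟩
      2 * S                                           ≡⟨ cong (_+_ S) (+-identityʳ S) ⟩
      S + S                                           ≡⟨ cong (_+ S) (sym (∑-involution _≟ᵛ_ (allBits d) (allBits-occursOnce d) σ σ-involutive success)) ⟩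
      (∑[ c ← allBits d ] success (σ c)) + S          ≡⟨ sym (∑-distrib-+ (allBits d) (λ c → success (σ c)) success) ⟩
      ∑[ c ← allBits d ] (success (σ c) + success c)  ≡⟨ ∑-cong success-σ (allBits d) ⟩
      ∑[ _ ← allBits d ] 1                            ≡⟨ sym (length≡∑1 (allBits d)) ⟩
      length (allBits d)                              ≡⟨ sym (length-map _ (allBits d)) ⟩
      length instances                                ∎
      where
      open ≡-Reasoning
      S = ∑ (allBits d) success

HardFamily : ℕ → ℕ → Set
HardFamily m d =
  Σ (List (BFun (suc m) d × BFun (suc m) d)) λ F →
    (1 ≤ length F)
    × All (λ p → IsUniqueClosestDirectSum (proj₁ p) (proj₂ p)) F
    × ((t : DTree (suc m) d) → ((f : BFun (suc m) d) → 4 * queries t f < suc m)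
        → 2 * successes t F ≤ length F)

4∣n⇒[1+n]^n≤4*n^n : ∀ n → 4 ∣ n → suc n ^ n ≤ 4 * n ^ n
4∣n⇒[1+n]^n≤4*n^n n (divides k n≡k*4) =
  subst (λ n → suc n ^ n ≤ 4 * n ^ n) (trans (k*4≡2*[k*2] k) (sym n≡k*4)) ([1+n]^n≤4*n^n (k * 2))
  where
  k*4≡2*[k*2] : ∀ k → 2 * (k * 2) ≡ k * 4
  k*4≡2*[k*2] = solve-∀

hardFamily : ∀ m d → 4 ∣ suc m → 7 ^ d * (2 * suc m) ^ suc m < 10 ^ d → HardFamily m d
hardFamily m zero     _   7⁰[2n]ⁿ<1 =
  ⊥-elim (<⇒≱ 7⁰[2n]ⁿ<1 (subst (1 ≤_) (sym (*-identityˡ _)) (m^n>0 (2 * suc m) (suc m))))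
hardFamily m (suc d′) 4∣n 7ᵈ[2n]ⁿ<10ᵈ =
  instances , nonempty , map⁺ (All.universal unique (allBits d)) ,
  λ t fewQueries → ≤-reflexive (halfSuccesses t fewQueries)
  where
  open HardInstance m d′
  nonempty : 1 ≤ length instances
  nonempty = subst (1 ≤_) (sym (trans (length-map _ (allBits d)) (length-allBits d))) (m^n>0 2 d)
  2n#exceptional<n^d : n * (#exceptional + #exceptional) < n ^ d
  2n#exceptional<n^d = n*[X+X]<n^d m d #exceptional threshold 7ᵈ[2n]ⁿ<10ᵈ
    (4∣n⇒[1+n]^n≤4*n^n n 4∣n) (manyOnes-count m d threshold) 4d<threshold*n
  unique : ∀ c → IsUniqueClosestDirectSum (masked c) (indicatorSum c)
  unique c = directSum-uniqueClosest (masked c) _ #exceptional (disagree-masked≤#exceptional c) 2n#exceptional<n^d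

mainTheorem5 : (m d : ℕ) → 4 ∣ suc m → (ε : ℚ) → 0ℚ <ℚ ε
    → ((+ 7 / 10) ^ℚ d) <ℚ (ε ^ℚ suc m)
    → ((+ suc m / 1) *ℚ ε) <ℚ ½
    → Σ (List (BFun (suc m) d × BFun (suc m) d)) λ F →
        (1 ≤ length F)
        × All (λ p → IsUniqueClosestDirectSum (proj₁ p) (proj₂ p)) F
        × ((t : DTree (suc m) d) → ((f : BFun (suc m) d) → 4 * queries t f < suc m)
            → 2 * successes t F ≤ length F)
mainTheorem5 m d 4∣n ε 0<ε [7/10]ᵈ<εⁿ nε<½ = hardFamily m d 4∣n (7ᵈ[2n]ⁿ<10ᵈ m d ε 0<ε [7/10]ᵈ<εⁿ nε<½)
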